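{- Let $s$ be a positive multiple of $3$. The circle graph $C$ on $6s+1$ vertices determined by the set $\{x\in\mathbb{Z}: 5s/3+1\le x\le 8s/3\}$ has no diameter two subgraph containing more than $2s+3$ vertices.
   Context: For an integer $n\ge 2$ and a set $S\subseteq\{1,\ldots,\lfloor n/2\rfloor\}$, the circle graph on $n$ vertices determined by $S$ is the graph with vertex set $\{0,1,\ldots,n-1\}$ in which two vertices $x,y$ are adjacent if and only if $(x-y)\bmod n\in S$ or $(y-x)\bmod n\in S$. A diameter two subgraph of a graph $G$ is a subgraph $H$ of $G$ such that for every pair of vertices $x,y$ of $H$ there is a path in $H$ joining $x$ and $y$ with at most two edges. -}

module Defs where

open import Data.Nat using (ℕ; zero; suc; _+_; _*_; _∸_; _≤_; NonZero)
open import Data.Nat.DivMod using (_%_)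
open import Data.Fin using (Fin; toℕ)
open import Data.Fin.Subset using (Subset; _∈_)
open import Data.Product using (_×_; Σ; ∃-syntax)
open import Data.Sum using (_⊎_)
open import Relation.Binary.PropositionalEquality using (_≡_)

CircleAdj : (n : ℕ) → .{{_ : NonZero n}} → (ℕ → Set) → Fin n → Fin n → Set
CircleAdj n S x y =
  S ((toℕ x + (n ∸ toℕ y)) % n) ⊎ S ((toℕ y + (n ∸ toℕ x)) % n)

record IsSubgraph {n : ℕ} (Adj : Fin n → Fin n → Set)
                  (V : Subset n) (E : Fin n → Fin n → Set) : Set where
  field
    edge-left  : ∀ {x y} → E x y → x ∈ V
    edge-right : ∀ {x y} → E x y → y ∈ V
    edge-adj   : ∀ {x y} → E x y → Adj x y
    edge-sym   : ∀ {x y} → E x y → E y x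

DiameterTwo : {n : ℕ} → Subset n → (Fin n → Fin n → Set) → Set
DiameterTwo {n} V E = ∀ x y → x ∈ V → y ∈ V →
  (x ≡ y) ⊎ E x y ⊎ (∃[ z ] (z ∈ V × E x z × E z y))

-- The set {x ∈ ℤ : 5s/3 + 1 ≤ x ≤ 8s/3} (restricted to ℕ, it consists of positive
-- integers), written without division: 5s + 3 ≤ 3x ≤ 8s.
Slab : ℕ → ℕ → Set
Slab s x = (5 * s + 3 ≤ 3 * x) × (3 * x ≤ 8 * s)

module Submission where

open import Defs
open import Data.Nat using (ℕ; suc; _+_; _*_; _≤_; _<_)
open import Data.Nat.Divisibility using (_∣_)
open import Data.Fin using (Fin)
open import Data.Fin.Subset using (Subset; ∣_∣)

open import Data.Bool using () renaming (true to inside; false to outside)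
open import Data.Empty using (⊥; ⊥-elim)
open import Data.Fin using (zero; fromℕ<; toℕ)
open import Data.Fin.Properties using (toℕ<n; toℕ-fromℕ<; fromℕ<-toℕ; fromℕ<-cong)
open import Data.Fin.Subset using (_∈_)
open import Data.Fin.Subset.Properties using (_∈?_; drop-there)
open import Data.Nat using (zero; _∸_; pred; NonZero; z≤n; s≤s)
open import Data.Nat.DivMod using (_%_; _mod_; %-distribˡ-+; m%n%n≡m%n; [m+n]%n≡m%n; m%n≤n; m%n<n; m<n⇒m%n≡m)
open import Data.Nat.Divisibility using (divides)
open import Data.Nat.Properties
open import Data.Nat.Tactic.RingSolver using (solve-∀)
open import Data.Product using (∃-syntax; _×_; _,_)
open import Data.Sum using (_⊎_; inj₁; inj₂; [_,_]′)
open import Data.Vec using ([]; _∷_; here; there)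
open import Function using (_∘_; case_of_)
open import Function.Bundles using (_⇔_; mk⇔; Equivalence)
open import Relation.Binary.Bundles using (Setoid)
open import Relation.Binary.Definitions using (_Respects_)
open import Relation.Binary.PropositionalEquality
open import Relation.Nullary using (¬_; Dec; yes; no; ¬?; _×-dec_)
open import Relation.Unary using (Decidable)

-- Write s = 3t, so n = 18t + 1, and read V as an n-periodic set of positions in ℕ.  Edges join
-- vertices at clockwise distance in [5t+1, 8t] ∪ [10t+1, 13t].  No distance in [8t+1, 10t] is a
-- sum of at most two such lengths modulo n, so every member is followed, 8t+1 steps ahead, by a
-- block of w = 2t non-members.  A distance d ∈ [3t, 5t] between members can only be bridged by
-- two long edges, and the block ahead of their middle vertex then lies between them; hence fewer
-- than 3t steps behind every member sits a member directly preceded by a block (call the block a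
-- start).  Per period let m count members, β blocks, σ starts and ν the remaining positions:
-- rotating by 8t+1 gives m ≤ β; members, blocks and the rest are disjoint, so m + β + ν ≤ n;
-- the w − 1 positions after a start are of the third kind and starts are at least w apart, so
-- (w − 1)σ ≤ ν; and m ≤ 3tσ.  These force m ≤ 6t + 2.

∑< : ℕ → (ℕ → ℕ) → ℕ
∑< zero    f = 0
∑< (suc n) f = f 0 + ∑< n (f ∘ suc)

syntax ∑< n (λ i → e) = ∑[ i < n ] e

∑-cong : ∀ n {f g : ℕ → ℕ} → (∀ {i} → i < n → f i ≡ g i) → ∑< n f ≡ ∑< n g
∑-cong zero    f≡g = refl
∑-cong (suc n) f≡g = cong₂ _+_ (f≡g (s≤s z≤n)) (∑-cong n (f≡g ∘ s≤s))

∑-mono-≤ : ∀ n {f g : ℕ → ℕ} → (∀ {i} → i < n → f i ≤ g i) → ∑< n f ≤ ∑< n g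
∑-mono-≤ zero    f≤g = z≤n
∑-mono-≤ (suc n) f≤g = +-mono-≤ (f≤g (s≤s z≤n)) (∑-mono-≤ n (f≤g ∘ s≤s))

∑-const : ∀ n c → ∑[ i < n ] c ≡ n * c
∑-const zero    c = refl
∑-const (suc n) c = cong (c +_) (∑-const n c)

∑-distrib-+ : ∀ n (f g : ℕ → ℕ) → ∑[ i < n ] (f i + g i) ≡ ∑< n f + ∑< n g
∑-distrib-+ zero    f g = refl
∑-distrib-+ (suc n) f g = begin
  f 0 + g 0 + ∑[ i < n ] (f (suc i) + g (suc i)) ≡⟨ cong (f 0 + g 0 +_) (∑-distrib-+ n (f ∘ suc) (g ∘ suc)) ⟩
  f 0 + g 0 + (∑< n (f ∘ suc) + ∑< n (g ∘ suc))   ≡⟨ +-interchange (f 0) (g 0) _ _ ⟩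
  f 0 + ∑< n (f ∘ suc) + (g 0 + ∑< n (g ∘ suc))   ∎
  where
  open ≡-Reasoning
  +-interchange : ∀ a b c d → a + b + (c + d) ≡ a + c + (b + d)
  +-interchange = solve-∀

∑-comm : ∀ m n (f : ℕ → ℕ → ℕ) → ∑[ i < m ] ∑[ j < n ] f i j ≡ ∑[ j < n ] ∑[ i < m ] f i j
∑-comm zero    n f = sym (trans (∑-const n 0) (*-zeroʳ n))
∑-comm (suc m) n f = trans (cong (∑< n (f 0) +_) (∑-comm m n (f ∘ suc)))
                           (sym (∑-distrib-+ n (f 0) (λ j → ∑[ i < m ] f (suc i) j)))

∑-snoc : ∀ n (f : ℕ → ℕ) → ∑< (suc n) f ≡ ∑< n f + f n
∑-snoc zero    f = +-comm (f 0) 0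
∑-snoc (suc n) f = trans (cong (f 0 +_) (∑-snoc n (f ∘ suc))) (sym (+-assoc (f 0) _ _))

∑-rotate : ∀ n (f : ℕ → ℕ) → (∀ i → f (i + n) ≡ f i) → ∀ k → ∑[ i < n ] f (i + k) ≡ ∑< n f
∑-rotate n f periodic zero    = ∑-cong n (λ {i} _ → cong f (+-identityʳ i))
∑-rotate n f periodic (suc k) = begin
  ∑[ i < n ] f (i + suc k) ≡⟨ ∑-cong n (λ {i} _ → cong f (+-suc i k)) ⟩
  ∑[ i < n ] g (suc i)     ≡⟨ +-cancelʳ-≡ (g 0) _ _ shift ⟩
  ∑< n g                   ≡⟨ ∑-rotate n f periodic k ⟩
  ∑< n f                   ∎
  where
  open ≡-Reasoning
  g : ℕ → ℕ
  g i = f (i + k)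
  shift : ∑[ i < n ] g (suc i) + g 0 ≡ ∑< n g + g 0
  shift = begin
    ∑[ i < n ] g (suc i) + g 0 ≡⟨ +-comm _ (g 0) ⟩
    ∑< (suc n) g               ≡⟨ ∑-snoc n g ⟩
    ∑< n g + g n               ≡⟨ cong (λ x → ∑< n g + f x) (+-comm n k) ⟩
    ∑< n g + f (k + n)         ≡⟨ cong (∑< n g +_) (periodic k) ⟩
    ∑< n g + g 0               ∎

χ : ∀ {a} {A : Set a} → Dec A → ℕ
χ (yes _) = 1
χ (no _)  = 0

χ-mono : ∀ {a b} {A : Set a} {B : Set b} {a? : Dec A} {b? : Dec B} → (A → B) → χ a? ≤ χ b?
χ-mono {a? = yes _} {yes _} _   = ≤-refl
χ-mono {a? = yes x} {no ¬y} A→B = ⊥-elim (¬y (A→B x))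
χ-mono {a? = no _}          _   = z≤n

χ-cong : ∀ {a b} {A : Set a} {B : Set b} {a? : Dec A} {b? : Dec B} → (A → B) → (B → A) → χ a? ≡ χ b?
χ-cong A→B B→A = ≤-antisym (χ-mono A→B) (χ-mono B→A)

χ-yes : ∀ {a} {A : Set a} {a? : Dec A} → A → χ a? ≡ 1
χ-yes {a? = yes _} _ = refl
χ-yes {a? = no ¬x} x = ⊥-elim (¬x x)

χ-no : ∀ {a} {A : Set a} {a? : Dec A} → ¬ A → χ a? ≡ 0
χ-no {a? = yes x} ¬x = ⊥-elim (¬x x)
χ-no {a? = no _}  _  = refl

χ-≤ : ∀ {a} {A : Set a} {a? : Dec A} {x} → (A → 1 ≤ x) → χ a? ≤ x
χ-≤ {a? = yes a} 1≤x = 1≤x a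
χ-≤ {a? = no _}  _   = z≤n

χ-partition : ∀ {a b} {A : Set a} {B : Set b} (a? : Dec A) (b? : Dec B) → (B → ¬ A) →
              χ a? + χ b? + χ (¬? a? ×-dec ¬? b?) ≤ 1
χ-partition (yes a) (yes b) B⇒¬A = ⊥-elim (B⇒¬A b a)
χ-partition (yes _) (no _)  _    = ≤-refl
χ-partition (no _)  (yes _) _    = ≤-refl
χ-partition (no _)  (no _)  _    = ≤-refl

∑χ-pos : ∀ {p} {P : ℕ → Set p} (P? : Decidable P) K {i} → i < K → P i → 1 ≤ ∑[ j < K ] χ (P? j)
∑χ-pos P? (suc K) {zero}  _         Pi = ≤-trans (≤-reflexive (sym (χ-yes {a? = P? 0} Pi))) (m≤m+n _ _)
∑χ-pos P? (suc K) {suc i} (s≤s i<K) Pi = ≤-trans (∑χ-pos (P? ∘ suc) K i<K Pi) (m≤n+m _ (χ (P? 0)))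

∑χ-atMostOne : ∀ {p q} {P : ℕ → Set p} {Q : Set q} (P? : Decidable P) (Q? : Dec Q) K →
               (∀ {i} → i < K → P i → Q) →
               (∀ {i j} → i < j → j < K → P i → P j → ⊥) →
               ∑[ i < K ] χ (P? i) ≤ χ Q?
∑χ-atMostOne P? Q? zero    P⇒Q unique = z≤n
∑χ-atMostOne P? Q? (suc K) P⇒Q unique with P? 0
... | no  _  = ∑χ-atMostOne (P? ∘ suc) Q? K (P⇒Q ∘ s≤s) (λ i<j j<K → unique (s≤s i<j) (s≤s j<K))
... | yes P0 = ≤-reflexive (begin
  suc (∑[ i < K ] χ (P? (suc i))) ≡⟨ cong suc (∑-cong K (λ i<K → χ-no (unique (s≤s z≤n) (s≤s i<K) P0))) ⟩
  suc (∑[ i < K ] 0)              ≡⟨ cong suc (trans (∑-const K 0) (*-zeroʳ K)) ⟩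
  1                               ≡⟨ χ-yes (P⇒Q (s≤s z≤n) P0) ⟨
  χ Q?                            ∎)
  where open ≡-Reasoning

∣p∣≡∑χ : ∀ {k} (V : Subset k) {P : ℕ → Set} (P? : Decidable P) →
         (∀ {i} (i<k : i < k) → P i ⇔ fromℕ< i<k ∈ V) → ∣ V ∣ ≡ ∑[ i < k ] χ (P? i)
∣p∣≡∑χ []      P? P⇔ = refl
∣p∣≡∑χ (b ∷ V) {P} P? P⇔ =
  trans (head b (P⇔ (s≤s z≤n))) (cong (χ (P? 0) +_) (∣p∣≡∑χ V (P? ∘ suc) tail))
  where
  tail : ∀ {i} (i<k : i < _) → P (suc i) ⇔ fromℕ< i<k ∈ V
  tail i<k = mk⇔ (drop-there ∘ Equivalence.to (P⇔ (s≤s i<k))) (Equivalence.from (P⇔ (s≤s i<k)) ∘ there)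
  head : ∀ b → P 0 ⇔ zero ∈ b ∷ V → ∣ b ∷ V ∣ ≡ χ (P? 0) + ∣ V ∣
  head inside  P0⇔ = cong (_+ ∣ V ∣) (sym (χ-yes (Equivalence.from P0⇔ here)))
  head outside P0⇔ = cong (_+ ∣ V ∣) (sym (χ-no (λ P0 → case Equivalence.to P0⇔ P0 of λ ())))

lastBelow : ∀ {p} {P : ℕ → Set p} (P? : Decidable P) → P 0 → ∀ {j} → 0 < j →
            ∃[ e ] e < j × P e × (∀ {e′} → e < e′ → e′ < j → ¬ P e′)
lastBelow P? P0 {suc zero}    _ = 0 , s≤s z≤n , P0 , λ { (s≤s _) (s≤s ()) }
lastBelow {P = P} P? P0 {suc (suc j)} _ with P? (suc j) | lastBelow P? P0 {suc j} (s≤s z≤n)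
... | yes Pj | _ = suc j , ≤-refl , Pj , λ e<e′ e′<j → ⊥-elim (<-irrefl refl (<-≤-trans e<e′ (≤-pred e′<j)))
... | no ¬Pj | e , e<j , Pe , later = e , m≤n⇒m≤1+n e<j , Pe , later′
  where
  later′ : ∀ {e′} → e < e′ → e′ < suc (suc j) → ¬ P e′
  later′ {e′} e<e′ e′<j with e′ ≟ suc j
  ... | yes refl = ¬Pj
  ... | no  e′≢j = later e<e′ (≤∧≢⇒< (≤-pred e′<j) e′≢j)

module Modular (n : ℕ) .{{_ : NonZero n}} where

  infix 4 _≈_
  record _≈_ (a b : ℕ) : Set where
    constructor mod-≡
    field %-≡ : a % n ≡ b % n

  ≈-setoid : Setoid _ _
  ≈-setoid = record
    { Carrier       = ℕ
    ; _≈_           = _≈_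
    ; isEquivalence = record
      { refl  = mod-≡ refl
      ; sym   = λ (mod-≡ p) → mod-≡ (sym p)
      ; trans = λ (mod-≡ p) (mod-≡ q) → mod-≡ (trans p q)
      }
    }

  open Setoid ≈-setoid public using () renaming (refl to ≈-refl; sym to ≈-sym; trans to ≈-trans)

  ≡⇒≈ : ∀ {a b} → a ≡ b → a ≈ b
  ≡⇒≈ refl = ≈-refl

  %-≈ : ∀ a → a % n ≈ a
  %-≈ a = mod-≡ (m%n%n≡m%n a n)

  toℕ-mod : ∀ a → toℕ (a mod n) ≈ a
  toℕ-mod a = ≈-trans (≡⇒≈ (toℕ-fromℕ< (m%n<n a n))) (%-≈ a)

  mod≡fromℕ< : ∀ {a} (a<n : a < n) → a mod n ≡ fromℕ< a<n
  mod≡fromℕ< {a} a<n = fromℕ<-cong _ _ (m<n⇒m%n≡m a<n) (m%n<n a n) a<n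

  +n-≈ : ∀ a → a + n ≈ a
  +n-≈ a = mod-≡ ([m+n]%n≡m%n a n)

  +-cong : ∀ {a b c d} → a ≈ b → c ≈ d → a + c ≈ b + d
  +-cong {a} {b} {c} {d} (mod-≡ a≈b) (mod-≡ c≈d) = mod-≡ (begin
    (a + c) % n           ≡⟨ %-distribˡ-+ a c n ⟩
    (a % n + c % n) % n   ≡⟨ cong₂ (λ x y → (x + y) % n) a≈b c≈d ⟩
    (b % n + d % n) % n   ≡⟨ %-distribˡ-+ b d n ⟨
    (b + d) % n           ∎)
    where open ≡-Reasoning

  +-cancelʳ-≈ : ∀ {a b} c → a + c ≈ b + c → a ≈ b
  +-cancelʳ-≈ {a} {b} c a+c≈b+c = ≈-trans (≈-sym (undo a)) (≈-trans (+-cong a+c≈b+c ≈-refl) (undo b))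
    where
    open import Relation.Binary.Reasoning.Setoid ≈-setoid
    undo : ∀ x → x + c + (n ∸ c % n) ≈ x
    undo x = begin
      x + c + (n ∸ c % n)       ≈⟨ +-cong (+-cong (≈-refl {x}) (≈-sym (%-≈ c))) ≈-refl ⟩
      x + c % n + (n ∸ c % n)   ≡⟨ +-assoc x (c % n) _ ⟩
      x + (c % n + (n ∸ c % n)) ≡⟨ cong (x +_) (m+[n∸m]≡n (m%n≤n c n)) ⟩
      x + n                     ≈⟨ +n-≈ x ⟩
      x                         ∎

  +-cancelˡ-≈ : ∀ {a b} c → c + a ≈ c + b → a ≈ b
  +-cancelˡ-≈ {a} {b} c c+a≈c+b =
    +-cancelʳ-≈ c (≈-trans (≡⇒≈ (+-comm a c)) (≈-trans c+a≈c+b (≡⇒≈ (+-comm c b))))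

  ≈⇒≡ : ∀ {a b} → a < n → b < n → a ≈ b → a ≡ b
  ≈⇒≡ a<n b<n (mod-≡ a≈b) = trans (sym (m<n⇒m%n≡m a<n)) (trans a≈b (m<n⇒m%n≡m b<n))

  ≈-split : ∀ {a d} → a ≈ d → d < n → a < n + n → a ≡ d ⊎ a ≡ d + n
  ≈-split {a} {d} a≈d d<n a<2n with a <? n
  ... | yes a<n = inj₁ (≈⇒≡ a<n d<n a≈d)
  ... | no  a≮n = inj₂ (trans (sym (m∸n+n≡m n≤a)) (cong (_+ n) a-n≡d))
    where
    n≤a : n ≤ a
    n≤a = ≮⇒≥ a≮n
    a-n≡d : a ∸ n ≡ d
    a-n≡d = ≈⇒≡ (m<n+o⇒m∸n<o a n a<2n) d<n
              (≈-trans (≈-sym (+n-≈ (a ∸ n))) (≈-trans (≡⇒≈ (m∸n+n≡m n≤a)) a≈d))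

  -- k steps back on the circle; truncated subtraction makes this meaningful only for k ≤ n.
  infixl 6 _⊖_
  _⊖_ : ℕ → ℕ → ℕ
  a ⊖ k = a + (n ∸ k)

  ⊖-+-cancel : ∀ a {k} → k ≤ n → a ⊖ k + k ≈ a
  ⊖-+-cancel a {k} k≤n = ≈-trans (≡⇒≈ (trans (+-assoc a (n ∸ k) k) (cong (a +_) (m∸n+n≡m k≤n)))) (+n-≈ a)

  ⊖-+-≈ : ∀ a {k x} → k ≤ n → k ≤ x → a ⊖ k + x ≈ a + (x ∸ k)
  ⊖-+-≈ a {k} {x} k≤n k≤x = begin
    a ⊖ k + x             ≡⟨ cong (a ⊖ k +_) (m+[n∸m]≡n k≤x) ⟨
    a ⊖ k + (k + (x ∸ k)) ≡⟨ +-assoc (a ⊖ k) k (x ∸ k) ⟨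
    a ⊖ k + k + (x ∸ k)   ≈⟨ +-cong (⊖-+-cancel a k≤n) ≈-refl ⟩
    a + (x ∸ k)           ∎
    where open import Relation.Binary.Reasoning.Setoid ≈-setoid

  ⊖-+-≡ : ∀ a {k x} → k ≤ n → x ≤ k → a ⊖ k + x ≡ a ⊖ (k ∸ x)
  ⊖-+-≡ a {k} {x} k≤n x≤k = begin
    a + (n ∸ k) + x   ≡⟨ +-assoc a (n ∸ k) x ⟩
    a + (n ∸ k + x)   ≡⟨ cong (a +_) (+-cancelʳ-≡ (k ∸ x) _ _ (trans both-n (sym (m∸n+n≡m k∸x≤n)))) ⟩
    a + (n ∸ (k ∸ x)) ∎
    where
    open ≡-Reasoning
    k∸x≤n : k ∸ x ≤ n
    k∸x≤n = ≤-trans (m∸n≤m k x) k≤n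
    both-n : n ∸ k + x + (k ∸ x) ≡ n
    both-n = begin
      n ∸ k + x + (k ∸ x)   ≡⟨ +-assoc (n ∸ k) x (k ∸ x) ⟩
      n ∸ k + (x + (k ∸ x)) ≡⟨ cong (n ∸ k +_) (m+[n∸m]≡n x≤k) ⟩
      n ∸ k + k             ≡⟨ m∸n+n≡m k≤n ⟩
      n                     ∎

counting-arithmetic : ∀ r {m β ν σ} → m ≤ β → m + β + ν ≤ 18 * suc r + 1 → (2 * r + 1) * σ ≤ ν →
                      m ≤ 3 * suc r * σ → m ≤ 6 * suc r + 2
counting-arithmetic r {m} {β} {ν} {σ} m≤β total ν-bound m≤3tσ with σ ≤? 2
... | yes σ≤2 = begin
  m             ≤⟨ m≤3tσ ⟩
  3 * suc r * σ ≤⟨ *-monoʳ-≤ (3 * suc r) σ≤2 ⟩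
  3 * suc r * 2 ≡⟨ six r ⟩
  6 * suc r     ≤⟨ m≤m+n (6 * suc r) 2 ⟩
  6 * suc r + 2 ∎
  where
  open ≤-Reasoning
  six : ∀ r → 3 * suc r * 2 ≡ 6 * suc r
  six = solve-∀
... | no σ≰2 = *-cancelˡ-≤ 2 (+-cancelʳ-≤ ((2 * r + 1) * 3) (2 * m) (2 * (6 * suc r + 2)) (begin
  2 * m + (2 * r + 1) * 3   ≤⟨ +-mono-≤ (≤-reflexive (double m)) (≤-trans (*-monoʳ-≤ (2 * r + 1) (≰⇒> σ≰2)) ν-bound) ⟩
  m + m + ν                 ≤⟨ +-monoˡ-≤ ν (+-monoʳ-≤ m m≤β) ⟩
  m + β + ν                 ≤⟨ total ⟩
  18 * suc r + 1            ≡⟨ split-total r ⟩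
  2 * (6 * suc r + 2) + (2 * r + 1) * 3 ∎))
  where
  open ≤-Reasoning
  double : ∀ m → 2 * m ≡ m + m
  double = solve-∀
  split-total : ∀ r → 18 * suc r + 1 ≡ 2 * (6 * suc r + 2) + (2 * r + 1) * 3
  split-total = solve-∀

module PeriodicCounting (n : ℕ) .{{_ : NonZero n}} (r : ℕ) (n≡ : n ≡ 18 * suc r + 1) where

  open Modular n

  t w : ℕ
  t = suc r
  w = 2 * t

  3t+w≤n : 3 * t + w ≤ n
  3t+w≤n = ≤-trans (m≤m+n (3 * t + w) (13 * t + 1)) (≤-reflexive (trans (split r) (sym n≡)))
    where
    split : ∀ r → 3 * suc r + 2 * suc r + (13 * suc r + 1) ≡ 18 * suc r + 1
    split = solve-∀

  w≤n : w ≤ n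
  w≤n = ≤-trans (m≤n+m w (3 * t)) 3t+w≤n

  pred-w : pred w ≡ 2 * r + 1
  pred-w = cong pred (w≡ r)
    where
    w≡ : ∀ r → 2 * suc r ≡ suc (2 * r + 1)
    w≡ = solve-∀

  module _ {Member : ℕ → Set} (member? : Decidable Member) (Member-resp : Member Respects _≈_)
           (gap-ahead : ∀ {z i} → i < w → Member z → ¬ Member (z + (8 * t + 1) + i))
           (window-behind : ∀ {u} → Member u →
                            ∃[ j ] 0 < j × j ≤ 3 * t × (∀ {i} → i < w → ¬ Member (u ⊖ (j + i))))
           where

    Block Start Other : ℕ → Set
    Block p = ∀ {i} → i < w → ¬ Member (p + i)
    Start p = Block p × Member (p + w)
    Other p = ¬ Member p × ¬ Block p

    block? : Decidable Block
    block? p = allUpTo? (λ i → ¬? (member? (p + i))) w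

    start? : Decidable Start
    start? p = block? p ×-dec member? (p + w)

    other? : Decidable Other
    other? p = ¬? (member? p) ×-dec ¬? (block? p)

    block-resp : Block Respects _≈_
    block-resp a≈b block i<w = block i<w ∘ Member-resp (+-cong (≈-sym a≈b) ≈-refl)

    start-resp : Start Respects _≈_
    start-resp a≈b (block , member) = block-resp a≈b block , Member-resp (+-cong a≈b ≈-refl) member

    count : ∀ {P : ℕ → Set} → Decidable P → ℕ
    count P? = ∑[ p < n ] χ (P? p)

    count-rotate : ∀ {P : ℕ → Set} (P? : Decidable P) → P Respects _≈_ →
                   ∀ k → ∑[ p < n ] χ (P? (p + k)) ≡ count P?
    count-rotate P? P-resp = ∑-rotate n (χ ∘ P?) (λ p → χ-cong (P-resp (+n-≈ p)) (P-resp (≈-sym (+n-≈ p))))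

    block⇒¬member : ∀ {p} → Block p → ¬ Member p
    block⇒¬member {p} block = block (s≤s z≤n) ∘ subst Member (sym (+-identityʳ p))

    block-clash : ∀ {b c x} → Block b → Member c → c ≈ b + x → x < w → ⊥
    block-clash block Mc c≈b+x x<w = block x<w (Member-resp c≈b+x Mc)

    start-behind⇒other : ∀ {p k} → 0 < k → k < w → Start (p ⊖ k) → Other p
    start-behind⇒other {p} {k} 0<k k<w (block , member) = not-member , not-block
      where
      k≤n : k ≤ n
      k≤n = ≤-trans (<⇒≤ k<w) w≤n
      not-member : ¬ Member p
      not-member Mp = block-clash block Mp (≈-sym (⊖-+-cancel p k≤n)) k<w
      not-block : ¬ Block p
      not-block block′ = block-clash block′ member (⊖-+-≈ p k≤n (<⇒≤ k<w)) (∸-monoʳ-< 0<k (<⇒≤ k<w))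

    starts-apart : ∀ {p k k′} → k′ < k → k ≤ w → Start (p ⊖ k) → Start (p ⊖ k′) → ⊥
    starts-apart {p} {k} {k′} k′<k k≤w (_ , member) (block′ , _) = block-clash block′ member position offset<w
      where
      open import Relation.Binary.Reasoning.Setoid ≈-setoid
      k′≤w∸k+k′ : k′ ≤ w ∸ k + k′
      k′≤w∸k+k′ = m≤n+m k′ (w ∸ k)
      position : p ⊖ k + w ≈ p ⊖ k′ + (w ∸ k + k′)
      position = begin
        p ⊖ k + w                  ≈⟨ ⊖-+-≈ p (≤-trans k≤w w≤n) k≤w ⟩
        p + (w ∸ k)                ≡⟨ cong (p +_) (m+n∸n≡m (w ∸ k) k′) ⟨
        p + (w ∸ k + k′ ∸ k′)      ≈⟨ ⊖-+-≈ p (≤-trans (<⇒≤ (<-≤-trans k′<k k≤w)) w≤n) k′≤w∸k+k′ ⟨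
        p ⊖ k′ + (w ∸ k + k′)      ∎
      offset<w : w ∸ k + k′ < w
      offset<w = <-≤-trans (+-monoʳ-< (w ∸ k) k′<k) (≤-reflexive (m∸n+n≡m k≤w))

    member⇒start-behind : ∀ {u} → Member u → ∃[ e ] e < 3 * t × Start (u ⊖ (e + w))
    member⇒start-behind {u} Mu with window-behind Mu
    ... | j , 0<j , j≤3t , window with lastBelow (λ e → member? (u ⊖ e)) (Member-resp (≈-sym (+n-≈ u)) Mu) 0<j
    ... | e , e<j , Mue , later = e , <-≤-trans e<j j≤3t , block , member
      where
      e+w≤n : e + w ≤ n
      e+w≤n = ≤-trans (+-monoˡ-≤ w (<⇒≤ (<-≤-trans e<j j≤3t))) 3t+w≤n
      member : Member (u ⊖ (e + w) + w)
      member = subst Member (sym (trans (⊖-+-≡ u e+w≤n (m≤n+m w e)) (cong (u ⊖_) (m+n∸n≡m e w)))) Mue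
      vacant : ∀ {d} → e < d → d ≤ e + w → ¬ Member (u ⊖ d)
      vacant {d} e<d d≤e+w with d <? j
      ... | yes d<j = later e<d d<j
      ... | no  d≮j = subst (¬_ ∘ Member ∘ (u ⊖_)) (m+[n∸m]≡n (≮⇒≥ d≮j))
                        (window (m<n+o⇒m∸n<o d j (≤-<-trans d≤e+w (+-monoˡ-< w e<j))))
      block : Block (u ⊖ (e + w))
      block {x} x<w = subst (¬_ ∘ Member) (sym (⊖-+-≡ u e+w≤n (≤-trans (<⇒≤ x<w) (m≤n+m w e))))
                        (vacant e<d (m∸n≤m (e + w) x))
        where
        e<d : e < e + w ∸ x
        e<d = subst (e <_) (sym (+-∸-assoc e (<⇒≤ x<w))) (m<m+n e (m<n⇒0<n∸m x<w))

    count-rotated-starts : ∀ K (offset : ℕ → ℕ) → ∑[ p < n ] ∑[ i < K ] χ (start? (p + offset i)) ≡ K * count start?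
    count-rotated-starts K offset = begin
      ∑[ p < n ] ∑[ i < K ] χ (start? (p + offset i)) ≡⟨ ∑-comm n K (λ p i → χ (start? (p + offset i))) ⟩
      ∑[ i < K ] ∑[ p < n ] χ (start? (p + offset i)) ≡⟨ ∑-cong K (λ {i} _ → count-rotate start? start-resp (offset i)) ⟩
      ∑[ i < K ] count start?                         ≡⟨ ∑-const K (count start?) ⟩
      K * count start?                                ∎
      where open ≡-Reasoning

    members≤blocks : count member? ≤ count block?
    members≤blocks = begin
      count member?                           ≤⟨ ∑-mono-≤ n (λ _ → χ-mono λ Mz i<w → gap-ahead i<w Mz) ⟩
      ∑[ p < n ] χ (block? (p + (8 * t + 1))) ≡⟨ count-rotate block? block-resp (8 * t + 1) ⟩
      count block?                            ∎
      where open ≤-Reasoning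

    members+blocks+others≤n : count member? + count block? + count other? ≤ n
    members+blocks+others≤n = begin
      count member? + count block? + count other?              ≡⟨ regroup ⟨
      ∑[ p < n ] (χ (member? p) + χ (block? p) + χ (other? p)) ≤⟨ ∑-mono-≤ n (λ {p} _ → exclusive p) ⟩
      ∑[ p < n ] 1                                             ≡⟨ trans (∑-const n 1) (*-identityʳ n) ⟩
      n                                                        ∎
      where
      open ≤-Reasoning
      regroup : ∑[ p < n ] (χ (member? p) + χ (block? p) + χ (other? p)) ≡ count member? + count block? + count other?
      regroup = trans (∑-distrib-+ n _ (χ ∘ other?)) (cong (_+ count other?) (∑-distrib-+ n (χ ∘ member?) (χ ∘ block?)))
      exclusive : ∀ p → χ (member? p) + χ (block? p) + χ (other? p) ≤ 1
      exclusive p = χ-partition (member? p) (block? p) block⇒¬member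

    starts≤others : pred w * count start? ≤ count other?
    starts≤others = begin
      pred w * count start?                           ≡⟨ count-rotated-starts (pred w) (λ i → n ∸ suc i) ⟨
      ∑[ p < n ] ∑[ i < pred w ] χ (start? (p ⊖ suc i)) ≤⟨ ∑-mono-≤ n (λ {p} _ → at-most-one p) ⟩
      count other?                                    ∎
      where
      open ≤-Reasoning
      at-most-one : ∀ p → ∑[ i < pred w ] χ (start? (p ⊖ suc i)) ≤ χ (other? p)
      at-most-one p = ∑χ-atMostOne (λ i → start? (p ⊖ suc i)) (other? p) (pred w)
        (λ i<K → start-behind⇒other (s≤s z≤n) (s≤s i<K))
        (λ i<j j<K Si Sj → starts-apart (s≤s i<j) (<⇒≤ (s≤s j<K)) Sj Si)

    members≤starts : count member? ≤ 3 * t * count start?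
    members≤starts = begin
      count member?                                        ≤⟨ ∑-mono-≤ n (λ {u} _ → χ-≤ (nearby-start u)) ⟩
      ∑[ u < n ] ∑[ e < 3 * t ] χ (start? (u ⊖ (e + w))) ≡⟨ count-rotated-starts (3 * t) (λ e → n ∸ (e + w)) ⟩
      3 * t * count start?                                 ∎
      where
      open ≤-Reasoning
      nearby-start : ∀ u → Member u → 1 ≤ ∑[ e < 3 * t ] χ (start? (u ⊖ (e + w)))
      nearby-start u Mu = let e , e<3t , start = member⇒start-behind Mu in
        ∑χ-pos (λ e → start? (u ⊖ (e + w))) (3 * t) e<3t start

    count-member≤ : count member? ≤ 6 * t + 2
    count-member≤ = counting-arithmetic r members≤blocks
      (subst (count member? + count block? + count other? ≤_) n≡ members+blocks+others≤n)
      (subst (_≤ count other?) (cong (_* count start?) pred-w) starts≤others)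
      members≤starts

module CircleGraph (r : ℕ) where

  t s n : ℕ
  t = suc r
  s = t * 3
  n = suc (6 * s)

  n≡ : n ≡ 18 * t + 1
  n≡ = n≡′ r
    where
    n≡′ : ∀ r → suc (6 * (suc r * 3)) ≡ 18 * suc r + 1
    n≡′ = solve-∀

  open Modular n
  open PeriodicCounting n r n≡ using (w; count-member≤)

  -- Clockwise lengths of edges: the slab, and its reflection n − slab.
  EdgeLength : ℕ → Set
  EdgeLength d = (5 * t + 1 ≤ d × d ≤ 8 * t) ⊎ (10 * t + 1 ≤ d × d ≤ 13 * t)

  ≤10t⇒<n : ∀ {d} → d ≤ 10 * t → d < n
  ≤10t⇒<n {d} d≤10t = s≤s (≤-trans d≤10t (≤-trans (*-monoˡ-≤ t (m≤m+n 10 8)) (≤-reflexive (18t≡ r))))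
    where
    18t≡ : ∀ r → 18 * suc r ≡ 6 * (suc r * 3)
    18t≡ = solve-∀

  edge≥ : ∀ {d} → EdgeLength d → 5 * t + 1 ≤ d
  edge≥ (inj₁ (5t<d , _)) = 5t<d
  edge≥ (inj₂ (10t<d , _)) = ≤-trans (+-monoˡ-≤ 1 (*-monoˡ-≤ t (m≤m+n 5 5))) 10t<d

  edge≤ : ∀ {d} → EdgeLength d → d ≤ 13 * t
  edge≤ (inj₁ (_ , d≤8t)) = ≤-trans d≤8t (*-monoˡ-≤ t (m≤m+n 8 5))
  edge≤ (inj₂ (_ , d≤13t)) = d≤13t

  edge-long : ∀ {d} → EdgeLength d → 8 * t + 1 ≤ d → 10 * t + 1 ≤ d
  edge-long (inj₁ (_ , d≤8t)) 8t<d = ⊥-elim (m+1+n≰m (8 * t) (≤-trans 8t<d d≤8t))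
  edge-long (inj₂ (10t<d , _)) _   = 10t<d

  edge∉gap : ∀ {d} → EdgeLength d → 8 * t + 1 ≤ d → d ≤ 10 * t → ⊥
  edge∉gap edge 8t<d d≤10t = m+1+n≰m (10 * t) (≤-trans (edge-long edge 8t<d) d≤10t)

  short-sum : ∀ {a b d} → EdgeLength a → EdgeLength b → a + b ≡ d → d ≤ 10 * t → ⊥
  short-sum {a} {b} {d} ea eb a+b≡d d≤10t = m+1+n≰m (10 * t) (begin
    10 * t + 2              ≡⟨ double r ⟩
    5 * t + 1 + (5 * t + 1) ≤⟨ +-mono-≤ (edge≥ ea) (edge≥ eb) ⟩
    a + b                   ≡⟨ a+b≡d ⟩
    d                       ≤⟨ d≤10t ⟩
    10 * t                  ∎)
    where
    open ≤-Reasoning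
    double : ∀ r → 10 * suc r + 2 ≡ 5 * suc r + 1 + (5 * suc r + 1)
    double = solve-∀

  long-sum : ∀ {a b d} → EdgeLength a → EdgeLength b → a + b ≡ d + n → 8 * t + 1 ≤ d → ⊥
  long-sum {a} {b} {d} ea eb a+b≡d+n 8t<d = m+1+n≰m (26 * t) (begin
    26 * t + 2                  ≡⟨ split r ⟩
    8 * t + 1 + (18 * t + 1)    ≤⟨ +-monoˡ-≤ (18 * t + 1) 8t<d ⟩
    d + (18 * t + 1)            ≡⟨ cong (d +_) n≡ ⟨
    d + n                       ≡⟨ a+b≡d+n ⟨
    a + b                       ≤⟨ +-mono-≤ (edge≤ ea) (edge≤ eb) ⟩
    13 * t + 13 * t             ≡⟨ double r ⟩
    26 * t                      ∎)
    where
    open ≤-Reasoning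
    split : ∀ r → 26 * suc r + 2 ≡ 8 * suc r + 1 + (18 * suc r + 1)
    split = solve-∀
    double : ∀ r → 13 * suc r + 13 * suc r ≡ 26 * suc r
    double = solve-∀

  long-second : ∀ {a b d} → EdgeLength a → EdgeLength b → a + b ≡ d + n → 3 * t ≤ d → 10 * t + 1 ≤ b
  long-second {a} {b} {d} ea eb a+b≡d+n 3t≤d = edge-long eb (+-cancelˡ-≤ (13 * t) _ _ (begin
    13 * t + (8 * t + 1)   ≡⟨ split r ⟩
    3 * t + (18 * t + 1)   ≤⟨ +-monoˡ-≤ (18 * t + 1) 3t≤d ⟩
    d + (18 * t + 1)       ≡⟨ cong (d +_) n≡ ⟨
    d + n                  ≡⟨ a+b≡d+n ⟨
    a + b                  ≤⟨ +-monoˡ-≤ b (edge≤ ea) ⟩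
    13 * t + b             ∎))
    where
    open ≤-Reasoning
    split : ∀ r → 13 * suc r + (8 * suc r + 1) ≡ 3 * suc r + (18 * suc r + 1)
    split = solve-∀

  second≤ : ∀ {a b d} → 10 * t + 1 ≤ a → a + b ≡ d + n → b ≤ d + 8 * t
  second≤ {a} {b} {d} 10t<a a+b≡d+n = +-cancelˡ-≤ (10 * t + 1) _ _ (begin
    10 * t + 1 + b         ≤⟨ +-monoˡ-≤ b 10t<a ⟩
    a + b                  ≡⟨ a+b≡d+n ⟩
    d + n                  ≡⟨ cong (d +_) n≡ ⟩
    d + (18 * t + 1)       ≡⟨ split r d ⟩
    10 * t + 1 + (d + 8 * t) ∎)
    where
    open ≤-Reasoning
    split : ∀ r d → d + (18 * suc r + 1) ≡ 10 * suc r + 1 + (d + 8 * suc r)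
    split = solve-∀

  -- Opaque because unfolding _%_ at this concrete modulus makes unification blow up.
  opaque
    dist : Fin n → Fin n → ℕ
    dist x y = (toℕ y ⊖ toℕ x) % n

    dist<n : ∀ x y → dist x y < n
    dist<n x y = m%n<n (toℕ y ⊖ toℕ x) n

    toℕ+dist : ∀ x y → toℕ x + dist x y ≈ toℕ y
    toℕ+dist x y = begin
      toℕ x + dist x y          ≡⟨ +-comm (toℕ x) (dist x y) ⟩
      dist x y + toℕ x          ≈⟨ +-cong (%-≈ (toℕ y ⊖ toℕ x)) ≈-refl ⟩
      toℕ y ⊖ toℕ x + toℕ x     ≈⟨ ⊖-+-cancel (toℕ y) (<⇒≤ (toℕ<n x)) ⟩
      toℕ y                     ∎
      where open import Relation.Binary.Reasoning.Setoid ≈-setoid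

    adjacent⇒slab : ∀ {x y} → CircleAdj n (Slab s) x y → Slab s (dist y x) ⊎ Slab s (dist x y)
    adjacent⇒slab adjacent = adjacent

  dist-unique : ∀ {x y d} → d < n → toℕ x + d ≈ toℕ y → dist x y ≡ d
  dist-unique {x} {y} d<n x+d≈y =
    ≈⇒≡ (dist<n x y) d<n (+-cancelˡ-≈ (toℕ x) (≈-trans (toℕ+dist x y) (≈-sym x+d≈y)))

  dist-self : ∀ x → dist x x ≡ 0
  dist-self x = dist-unique (s≤s z≤n) (≡⇒≈ (+-identityʳ (toℕ x)))

  dist-+ : ∀ x y z → dist x y + dist y z ≡ dist x z ⊎ dist x y + dist y z ≡ dist x z + n
  dist-+ x y z = ≈-split (+-cancelˡ-≈ (toℕ x) (begin
    toℕ x + (dist x y + dist y z) ≡⟨ +-assoc (toℕ x) (dist x y) (dist y z) ⟨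
    toℕ x + dist x y + dist y z   ≈⟨ +-cong (toℕ+dist x y) ≈-refl ⟩
    toℕ y + dist y z              ≈⟨ toℕ+dist y z ⟩
    toℕ z                         ≈⟨ toℕ+dist x z ⟨
    toℕ x + dist x z              ∎))
    (dist<n x z) (+-mono-< (dist<n x y) (dist<n y z))
    where open import Relation.Binary.Reasoning.Setoid ≈-setoid

  dist-+-reverse : ∀ x y → dist x y + dist y x ≡ 0 ⊎ dist x y + dist y x ≡ n
  dist-+-reverse x y = subst (λ o → dist x y + dist y x ≡ o ⊎ dist x y + dist y x ≡ o + n) (dist-self x) (dist-+ x y x)

  slab-bounds : ∀ {d} → Slab s d → 5 * t + 1 ≤ d × d ≤ 8 * t
  slab-bounds {d} (lower , upper) =
    *-cancelˡ-≤ 3 (subst (_≤ 3 * d) (lower≡ r) lower) , *-cancelˡ-≤ 3 (subst (3 * d ≤_) (upper≡ r) upper)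
    where
    lower≡ : ∀ r → 5 * (suc r * 3) + 3 ≡ 3 * (5 * suc r + 1)
    lower≡ = solve-∀
    upper≡ : ∀ r → 8 * (suc r * 3) ≡ 3 * (8 * suc r)
    upper≡ = solve-∀

  opposite-edge : ∀ {a d} → 5 * t + 1 ≤ d × d ≤ 8 * t → a + d ≡ 0 ⊎ a + d ≡ n → EdgeLength a
  opposite-edge {a} {d} (5t<d , _) (inj₁ a+d≡0) =
    ⊥-elim (case ≤-trans 5t<d (≤-trans (m≤n+m d a) (≤-reflexive a+d≡0)) of λ ())
  opposite-edge {a} {d} (5t<d , d≤8t) (inj₂ a+d≡n) =
    inj₂ (+-cancelʳ-≤ (8 * t) _ _ lower , +-cancelʳ-≤ (5 * t + 1) _ _ upper)
    where
    open ≤-Reasoning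
    lower : 10 * t + 1 + 8 * t ≤ a + 8 * t
    lower = begin
      10 * t + 1 + 8 * t ≡⟨ split₁ r ⟩
      18 * t + 1         ≡⟨ trans a+d≡n n≡ ⟨
      a + d              ≤⟨ +-monoʳ-≤ a d≤8t ⟩
      a + 8 * t          ∎
      where
      split₁ : ∀ r → 10 * suc r + 1 + 8 * suc r ≡ 18 * suc r + 1
      split₁ = solve-∀
    upper : a + (5 * t + 1) ≤ 13 * t + (5 * t + 1)
    upper = begin
      a + (5 * t + 1)    ≤⟨ +-monoʳ-≤ a 5t<d ⟩
      a + d              ≡⟨ trans a+d≡n n≡ ⟩
      18 * t + 1         ≡⟨ split₂ r ⟩
      13 * t + (5 * t + 1) ∎
      where
      split₂ : ∀ r → 18 * suc r + 1 ≡ 13 * suc r + (5 * suc r + 1)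
      split₂ = solve-∀

  adjacent⇒edge : ∀ {x y} → CircleAdj n (Slab s) x y → EdgeLength (dist x y)
  adjacent⇒edge {x} {y} adjacent with adjacent⇒slab adjacent
  ... | inj₂ slab = inj₁ (slab-bounds slab)
  ... | inj₁ slab = opposite-edge (slab-bounds slab) (dist-+-reverse x y)

  module _ (V : Subset n) (E : Fin n → Fin n → Set) (subgraph : IsSubgraph (CircleAdj n (Slab s)) V E)
           (diameter-two : DiameterTwo V E) where

    open IsSubgraph subgraph

    Member : ℕ → Set
    Member p = p mod n ∈ V

    member? : Decidable Member
    member? p = p mod n ∈? V

    Member-resp : Member Respects _≈_
    Member-resp {a} {b} (mod-≡ a%n≡b%n) = subst (_∈ V) (fromℕ<-cong _ _ a%n≡b%n (m%n<n a n) (m%n<n b n))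

    ∈⇒Member : ∀ {x} → x ∈ V → Member (toℕ x)
    ∈⇒Member {x} = subst (_∈ V) (sym (trans (mod≡fromℕ< (toℕ<n x)) (fromℕ<-toℕ x (toℕ<n x))))

    dist-mod : ∀ {p q d} → d < n → p + d ≈ q → dist (p mod n) (q mod n) ≡ d
    dist-mod {p} {q} d<n p+d≈q =
      dist-unique d<n (≈-trans (+-cong (toℕ-mod p) ≈-refl) (≈-trans p+d≈q (≈-sym (toℕ-mod q))))

    record Detour (q d : ℕ) : Set where
      field
        via first second : ℕ
        via-member       : Member via
        arrives          : via + second ≈ q
        first-edge       : EdgeLength first
        second-edge      : EdgeLength second
        length           : first + second ≡ d ⊎ first + second ≡ d + n

    reach : ∀ {p q d} → Member p → Member q → p + d ≈ q → d < n → d ≡ 0 ⊎ EdgeLength d ⊎ Detour q d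
    reach {p} {q} {d} Mp Mq p+d≈q d<n = route (diameter-two x y Mp Mq)
      where
      x y : Fin n
      x = p mod n
      y = q mod n
      dist≡d : dist x y ≡ d
      dist≡d = dist-mod d<n p+d≈q
      route : x ≡ y ⊎ E x y ⊎ ∃[ z ] (z ∈ V × E x z × E z y) → d ≡ 0 ⊎ EdgeLength d ⊎ Detour q d
      route (inj₁ x≡y)                  = inj₁ (trans (sym dist≡d) (trans (cong (dist x) (sym x≡y)) (dist-self x)))
      route (inj₂ (inj₁ x~y))           = inj₂ (inj₁ (subst EdgeLength dist≡d (adjacent⇒edge (edge-adj x~y))))
      route (inj₂ (inj₂ (z , z∈V , x~z , z~y))) = inj₂ (inj₂ (record
        { via         = toℕ z
        ; first       = dist x z
        ; second      = dist z y
        ; via-member  = ∈⇒Member z∈V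
        ; arrives     = ≈-trans (toℕ+dist z y) (toℕ-mod q)
        ; first-edge  = adjacent⇒edge (edge-adj x~z)
        ; second-edge = adjacent⇒edge (edge-adj z~y)
        ; length      = subst (λ o → dist x z + dist z y ≡ o ⊎ dist x z + dist z y ≡ o + n) dist≡d (dist-+ x z y)
        }))

    gap-unreachable : ∀ {q d} → 8 * t + 1 ≤ d → d ≤ 10 * t → ¬ (d ≡ 0 ⊎ EdgeLength d ⊎ Detour q d)
    gap-unreachable 8t<d _     (inj₁ refl)           = case 8t<d of λ ()
    gap-unreachable 8t<d d≤10t (inj₂ (inj₁ edge))    = edge∉gap edge 8t<d d≤10t
    gap-unreachable 8t<d d≤10t (inj₂ (inj₂ detour)) =
      [ (λ short → short-sum first-edge second-edge short d≤10t)
      , (λ long → long-sum first-edge second-edge long 8t<d)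
      ]′ length
      where open Detour detour

    gap-ahead : ∀ {z i} → i < w → Member z → ¬ Member (z + (8 * t + 1) + i)
    gap-ahead {z} {i} i<w Mz Mz+e =
      gap-unreachable (m≤m+n (8 * t + 1) i) e≤10t (reach Mz Mz+e (≡⇒≈ (sym (+-assoc z (8 * t + 1) i))) (≤10t⇒<n e≤10t))
      where
      open ≤-Reasoning
      e≤10t : 8 * t + 1 + i ≤ 10 * t
      e≤10t = begin
        8 * t + 1 + i   ≡⟨ +-assoc (8 * t) 1 i ⟩
        8 * t + suc i   ≤⟨ +-monoʳ-≤ (8 * t) i<w ⟩
        8 * t + 2 * t   ≡⟨ sum r ⟩
        10 * t          ∎
        where
        sum : ∀ r → 8 * suc r + 2 * suc r ≡ 10 * suc r
        sum = solve-∀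

    -- Only two long edges join u ⊖ d to u, and the gap ahead of their middle vertex lies in between.
    window-between : ∀ {u d} → Member u → Member (u ⊖ d) → 3 * t ≤ d → d ≤ 5 * t →
                    ∃[ j ] 0 < j × j + w ≤ d × (∀ {i} → i < w → ¬ Member (u ⊖ (j + i)))
    window-between {u} {d} Mu Mu⊖d 3t≤d d≤5t = route (reach Mu⊖d Mu (⊖-+-cancel u (<⇒≤ d<n)) d<n)
      where
      d≤10t : d ≤ 10 * t
      d≤10t = ≤-trans d≤5t (*-monoˡ-≤ t (m≤m+n 5 5))
      d<n : d < n
      d<n = ≤10t⇒<n d≤10t
      route : d ≡ 0 ⊎ EdgeLength d ⊎ Detour u d →
              ∃[ j ] 0 < j × j + w ≤ d × (∀ {i} → i < w → ¬ Member (u ⊖ (j + i)))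
      route (inj₁ refl)           = ⊥-elim (case 3t≤d of λ ())
      route (inj₂ (inj₁ edge))    = ⊥-elim (m+1+n≰m (5 * t) (≤-trans (edge≥ edge) d≤5t))
      route (inj₂ (inj₂ detour)) = [ (λ short → ⊥-elim (short-sum first-edge second-edge short d≤10t)) , window ]′ length
        where
        open Detour detour
        window : first + second ≡ d + n → ∃[ j ] 0 < j × j + w ≤ d × (∀ {i} → i < w → ¬ Member (u ⊖ (j + i)))
        window long = j , 0<j , j+w≤d , vacant
          where
          10t<second : 10 * t + 1 ≤ second
          10t<second = long-second first-edge second-edge long 3t≤d
          10t<first : 10 * t + 1 ≤ first
          10t<first = long-second second-edge first-edge (trans (+-comm second first) long) 3t≤d
          j : ℕ
          j = second ∸ 10 * t
          second≡ : 10 * t + j ≡ second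
          second≡ = m+[n∸m]≡n (≤-trans (m≤m+n (10 * t) 1) 10t<second)
          0<j : 0 < j
          0<j = m<n⇒0<n∸m (subst (_≤ second) (+-comm (10 * t) 1) 10t<second)
          j+w≤d : j + w ≤ d
          j+w≤d = +-cancelʳ-≤ (8 * t) _ _ (begin
            j + w + 8 * t ≡⟨ rearrange r j ⟩
            10 * t + j    ≡⟨ second≡ ⟩
            second        ≤⟨ second≤ 10t<first long ⟩
            d + 8 * t     ∎)
            where
            open ≤-Reasoning
            rearrange : ∀ r j → j + 2 * suc r + 8 * suc r ≡ 10 * suc r + j
            rearrange = solve-∀
          vacant : ∀ {i} → i < w → ¬ Member (u ⊖ (j + i))
          vacant {i} i<w =
            gap-ahead {via} {w ∸ suc i} (∸-monoʳ-< (s≤s z≤n) i<w) via-member ∘ Member-resp {u ⊖ (j + i)} position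
            where
            j+i≤n : j + i ≤ n
            j+i≤n = ≤-trans (+-monoʳ-≤ j (<⇒≤ i<w)) (≤-trans j+w≤d (<⇒≤ d<n))
            offsets : via + (8 * t + 1) + (w ∸ suc i) + (j + i) ≡ via + second
            offsets = begin
              via + (8 * t + 1) + (w ∸ suc i) + (j + i) ≡⟨ rearrange via r (w ∸ suc i) i j ⟩
              via + (8 * t + (suc i + (w ∸ suc i)) + j) ≡⟨ cong (λ x → via + (8 * t + x + j)) (m+[n∸m]≡n i<w) ⟩
              via + (8 * t + 2 * t + j)                 ≡⟨ cong (via +_) (sum r j) ⟩
              via + (10 * t + j)                        ≡⟨ cong (via +_) second≡ ⟩
              via + second                              ∎
              where
              open ≡-Reasoning
              rearrange : ∀ s r c i j → s + (8 * suc r + 1) + c + (j + i) ≡ s + (8 * suc r + (suc i + c) + j)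
              rearrange = solve-∀
              sum : ∀ r j → 8 * suc r + 2 * suc r + j ≡ 10 * suc r + j
              sum = solve-∀
            position : u ⊖ (j + i) ≈ via + (8 * t + 1) + (w ∸ suc i)
            position = +-cancelʳ-≈ (j + i) (begin
              u ⊖ (j + i) + (j + i)                      ≈⟨ ⊖-+-cancel u j+i≤n ⟩
              u                                          ≈⟨ arrives ⟨
              via + second                              ≡⟨ offsets ⟨
              via + (8 * t + 1) + (w ∸ suc i) + (j + i) ∎)
              where open import Relation.Binary.Reasoning.Setoid ≈-setoid

    window-behind : ∀ {u} → Member u → ∃[ j ] 0 < j × j ≤ 3 * t × (∀ {i} → i < w → ¬ Member (u ⊖ (j + i)))
    window-behind {u} Mu = search (anyUpTo? (λ i → member? (u ⊖ (3 * t + i))) w)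
      where
      search : Dec (∃[ i ] i < w × Member (u ⊖ (3 * t + i))) →
               ∃[ j ] 0 < j × j ≤ 3 * t × (∀ {i} → i < w → ¬ Member (u ⊖ (j + i)))
      search (no none)           = 3 * t , s≤s z≤n , ≤-refl , λ i<w M → none (_ , i<w , M)
      search (yes (i , i<w , M)) =
        let j , 0<j , j+w≤d , vacant = window-between {u} {3 * t + i} Mu M (m≤m+n (3 * t) i) 3t+i≤5t
        in  j , 0<j , <⇒≤ (+-cancelʳ-< w j (3 * t) (≤-<-trans j+w≤d (+-monoʳ-< (3 * t) i<w))) , vacant
        where
        3t+i≤5t : 3 * t + i ≤ 5 * t
        3t+i≤5t = ≤-trans (+-monoʳ-≤ (3 * t) (<⇒≤ i<w)) (≤-reflexive (sum r))
          where
          sum : ∀ r → 3 * suc r + 2 * suc r ≡ 5 * suc r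
          sum = solve-∀

    ∣V∣≤2s+3 : ∣ V ∣ ≤ 2 * s + 3
    ∣V∣≤2s+3 = begin
      ∣ V ∣                      ≡⟨ ∣p∣≡∑χ V member? member⇔ ⟩
      ∑[ p < n ] χ (member? p)   ≤⟨ count-member≤ member? Member-resp (λ {z} → gap-ahead {z}) (λ {u} → window-behind {u}) ⟩
      6 * t + 2                  ≤⟨ n≤1+n (6 * t + 2) ⟩
      suc (6 * t + 2)            ≡⟨ sum r ⟩
      2 * s + 3                  ∎
      where
      open ≤-Reasoning
      member⇔ : ∀ {i} (i<n : i < n) → Member i ⇔ fromℕ< i<n ∈ V
      member⇔ i<n = mk⇔ (subst (_∈ V) (mod≡fromℕ< i<n)) (subst (_∈ V) (sym (mod≡fromℕ< i<n)))
      sum : ∀ r → suc (6 * suc r + 2) ≡ 2 * (suc r * 3) + 3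
      sum = solve-∀

lemma4 : (s : ℕ) → 0 < s → 3 ∣ s →
         (V : Subset (suc (6 * s))) → (E : Fin (suc (6 * s)) → Fin (suc (6 * s)) → Set) →
         IsSubgraph (CircleAdj (suc (6 * s)) (Slab s)) V E →
         DiameterTwo V E →
         ∣ V ∣ ≤ 2 * s + 3
lemma4 _ 0<s (divides zero refl)    _ _ _        _            = ⊥-elim (<-irrefl refl 0<s)
lemma4 _ _   (divides (suc r) refl) V E subgraph diameter-two = CircleGraph.∣V∣≤2s+3 r V E subgraph diameter-two
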